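{- Let $G$ be a connected graph such that $D(G^c)=2$, and let $S\subseteq V(G)$. Then the following are equivalent: (a) $S$ is a strong metric generator for both $G$ and $G^c$; (b) $S$ is a strong resolving cover for $G$.
   Context: All graphs are finite, simple and undirected; $G^c$ denotes the complement of $G$ on the same vertex set and $D(H)$ the diameter of a connected graph $H$. For a connected graph $H$, $d_H(x,y)$ is the length of a shortest $x$–$y$ path. A vertex $w$ strongly resolves two vertices $u,v$ of $H$ if $d_H(u,w)=d_H(u,v)+d_H(v,w)$ or $d_H(v,w)=d_H(v,u)+d_H(u,w)$. A set $S\subseteq V(H)$ is a strong metric generator for $H$ if every two distinct vertices of $H$ are strongly resolved by some vertex of $S$. A vertex cover of $G$ is a set of vertices incident with every edge of $G$. A strong resolving cover for $G$ is a set that is both a vertex cover of $G$ and a strong metric generator for $G$. -}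

module Defs where

open import Data.Nat using (ℕ; zero; suc; _+_; _≤_)
open import Data.Fin using (Fin)
open import Data.Fin.Subset using (Subset; _∈_)
open import Data.Product using (Σ; ∃; ∃-syntax; _×_; _,_)
open import Data.Sum using (_⊎_)
open import Relation.Nullary using (¬_; Dec)
open import Relation.Binary.PropositionalEquality using (_≡_; _≢_; sym)

record Graph (n : ℕ) : Set₁ where
  field
    Adj     : Fin n → Fin n → Set
    adj?    : ∀ x y → Dec (Adj x y)
    sym-adj : ∀ {x y} → Adj x y → Adj y x
    irrefl  : ∀ {x} → ¬ Adj x x
open Graph public

complement : ∀ {n} → Graph n → Graph n
complement {n} G = record
  { Adj     = λ x y → (x ≢ y) × ¬ Adj G x y
  ; adj?    = dec
  ; sym-adj = λ { (x≢y , ¬a) → (λ e → x≢y (sym e)) , (λ a → ¬a (sym-adj G a)) }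
  ; irrefl  = λ { (x≢x , _) → x≢x _≡_.refl }
  }
  where
  open import Data.Fin using (_≟_)
  open import Relation.Nullary using (yes; no)
  open import Relation.Nullary.Decidable using (_×-dec_; ¬?)
  dec : ∀ x y → Dec ((x ≢ y) × ¬ Adj G x y)
  dec x y = ¬? (x ≟ y) ×-dec ¬? (adj? G x y)

data Walk {n : ℕ} (G : Graph n) : Fin n → Fin n → ℕ → Set where
  nil  : ∀ {x} → Walk G x x zero
  cons : ∀ {x y z k} → Adj G x y → Walk G y z k → Walk G x z (suc k)

Connected : ∀ {n} → Graph n → Set
Connected G = ∀ x y → ∃[ k ] Walk G x y k

Dist : ∀ {n} → Graph n → Fin n → Fin n → ℕ → Set
Dist G x y k = Walk G x y k × (∀ m → Walk G x y m → k ≤ m)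

Diameter : ∀ {n} → Graph n → ℕ → Set
Diameter G d =
  Connected G ×
  (∀ x y k → Dist G x y k → k ≤ d) ×
  (∃[ x ] ∃[ y ] Dist G x y d)

StronglyResolves : ∀ {n} → Graph n → Fin n → Fin n → Fin n → Set
StronglyResolves G w u v =
  ∃[ a ] ∃[ b ] ∃[ c ]
    Dist G u w a × Dist G u v b × Dist G v w c ×
    (a ≡ b + c ⊎ c ≡ b + a)

StrongMetricGenerator : ∀ {n} → Graph n → Subset n → Set
StrongMetricGenerator G S =
  ∀ u v → u ≢ v → ∃[ w ] (w ∈ S × StronglyResolves G w u v)

VertexCover : ∀ {n} → Graph n → Subset n → Set
VertexCover G S = ∀ x y → Adj G x y → (x ∈ S ⊎ y ∈ S)

StrongResolvingCover : ∀ {n} → Graph n → Subset n → Set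
StrongResolvingCover G S = VertexCover G S × StrongMetricGenerator G S

-- Two vertices adjacent in G are at distance 2 = D(Gᶜ) in Gᶜ, and a diametral pair is strongly
-- resolved only by its own endpoints; so a strong metric generator of Gᶜ meets every edge of G.
-- Conversely, two vertices u, v outside a vertex cover S are adjacent in Gᶜ.  If w ∈ S strongly
-- resolves them in G with d(u,w) = d(u,v) + d(v,w), the successor z of v on a shortest v–w path
-- lies in S (it covers the edge vz) and is neither u nor a G-neighbour of u, so in Gᶜ
-- d(v,z) = 2 = d(v,u) + d(u,z).

module Submission where

open import Defs
open import Data.Nat using (ℕ; zero; suc; _+_; _≤_; _<_; z≤n; s≤s; s≤s⁻¹)
open import Data.Nat.Properties
  using (≤-antisym; ≮⇒≥; n≮n; m<1+n⇒m<n∨m≡n; m+n≤o⇒n≤o; m+1+n≰m; +-suc; +-identityʳ)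
open import Data.Fin using (_≟_)
open import Data.Fin.Properties using (any?)
open import Data.Fin.Subset using (Subset; _∈_; _∉_)
open import Data.Fin.Subset.Properties using (_∈?_)
open import Data.Product using (_×_; _,_; ∃-syntax; proj₂)
open import Data.Sum using (_⊎_; inj₁; inj₂)
open import Data.Empty using (⊥-elim)
open import Relation.Nullary using (¬_; Dec; yes; no)
open import Relation.Nullary.Decidable using (map′; _×-dec_)
open import Relation.Unary using (Decidable)
open import Relation.Binary.PropositionalEquality using (_≡_; _≢_; refl; sym; subst; ≢-sym)
open import Function.Bundles using (_⇔_; mk⇔)

least-witness : ∀ {p} {P : ℕ → Set p} → Decidable P →
  ∀ {k} → P k → ∃[ m ] (P m × ∀ j → P j → m ≤ j)
least-witness {P = P} P? {k} pk = search k 0 (λ _ ()) (subst P (sym (+-identityʳ k)) pk)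
  where
  search : ∀ fuel i → (∀ j → j < i → ¬ P j) → P (fuel + i) →
    ∃[ m ] (P m × ∀ j → P j → m ≤ j)
  search fuel i below p with P? i
  ... | yes pi = i , pi , λ j pj → ≮⇒≥ (λ j<i → below j j<i pj)
  search zero i below pi | no ¬pi = ⊥-elim (¬pi pi)
  search (suc fuel) i below p | no ¬pi = search fuel (suc i) below′ (subst P (sym (+-suc fuel i)) p)
    where
    below′ : ∀ j → j < suc i → ¬ P j
    below′ j j<1+i with m<1+n⇒m<n∨m≡n j<1+i
    ... | inj₁ j<i = below j j<i
    ... | inj₂ refl = ¬pi

module _ {n : ℕ} (G : Graph n) where

  Adj⇒≢ : ∀ {x y} → Adj G x y → x ≢ y
  Adj⇒≢ a refl = irrefl G a

  Walk₀⇒≡ : ∀ {x y} → Walk G x y 0 → x ≡ y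
  Walk₀⇒≡ nil = refl

  snoc : ∀ {x y z k} → Walk G x y k → Adj G y z → Walk G x z (suc k)
  snoc nil a = cons a nil
  snoc (cons b w) a = cons b (snoc w a)

  reverse : ∀ {x y k} → Walk G x y k → Walk G y x k
  reverse nil = nil
  reverse (cons a w) = snoc (reverse w) (sym-adj G a)

  walk? : ∀ k x y → Dec (Walk G x y k)
  walk? zero x y = map′ (λ { refl → nil }) Walk₀⇒≡ (x ≟ y)
  walk? (suc k) x y =
    map′ (λ { (_ , a , w) → cons a w }) (λ { (cons a w) → _ , a , w })
         (any? λ z → adj? G x z ×-dec walk? k z y)

  Walk⇒∃Dist : ∀ {x y k} → Walk G x y k → ∃[ d ] Dist G x y d
  Walk⇒∃Dist {x} {y} = least-witness (λ m → walk? m x y)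

  Connected⇒∃Dist : Connected G → ∀ x y → ∃[ d ] Dist G x y d
  Connected⇒∃Dist connected x y = Walk⇒∃Dist (proj₂ (connected x y))

  Dist-refl : ∀ {x} → Dist G x x 0
  Dist-refl = nil , λ _ _ → z≤n

  Dist-sym : ∀ {x y d} → Dist G x y d → Dist G y x d
  Dist-sym (w , shortest) = reverse w , λ m w′ → shortest m (reverse w′)

  Dist-unique : ∀ {x y d e} → Dist G x y d → Dist G x y e → d ≡ e
  Dist-unique (w , shortest) (w′ , shortest′) = ≤-antisym (shortest _ w′) (shortest′ _ w)

  Adj⇒Dist₁ : ∀ {x y} → Adj G x y → Dist G x y 1
  Adj⇒Dist₁ {x} {y} a = cons a nil , shortest
    where
    shortest : ∀ m → Walk G x y m → 1 ≤ m
    shortest zero w = ⊥-elim (irrefl G (subst (Adj G x) (sym (Walk₀⇒≡ w)) a))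
    shortest (suc _) _ = s≤s z≤n

  Dist₂ : ∀ {x y z} → Adj G x y → Adj G y z → x ≢ z → ¬ Adj G x z → Dist G x z 2
  Dist₂ {x} {z = z} a b x≢z ¬a = cons a (cons b nil) , shortest
    where
    shortest : ∀ m → Walk G x z m → 2 ≤ m
    shortest zero w = ⊥-elim (x≢z (Walk₀⇒≡ w))
    shortest (suc zero) (cons a′ w) = ⊥-elim (¬a (subst (Adj G x) (Walk₀⇒≡ w) a′))
    shortest (suc (suc _)) _ = s≤s (s≤s z≤n)

  StronglyResolves-sym : ∀ {w u v} → StronglyResolves G w u v → StronglyResolves G w v u
  StronglyResolves-sym (a , b , c , duw , duv , dvw , inj₁ eq) = c , b , a , dvw , Dist-sym duv , duw , inj₂ eq
  StronglyResolves-sym (a , b , c , duw , duv , dvw , inj₂ eq) = c , b , a , dvw , Dist-sym duv , duw , inj₁ eq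

  endpoint-resolvesˡ : ∀ {u v d} → Dist G u v d → StronglyResolves G u u v
  endpoint-resolvesˡ {d = d} duv = 0 , d , d , Dist-refl , duv , Dist-sym duv , inj₂ (sym (+-identityʳ d))

  endpoint-resolvesʳ : ∀ {u v d} → Dist G u v d → StronglyResolves G v u v
  endpoint-resolvesʳ {d = d} duv = d , d , 0 , duv , duv , Dist-refl , inj₁ (sym (+-identityʳ d))

  diametral-resolver : ∀ {d x y w} → Diameter G d → Dist G x y d →
    StronglyResolves G w x y → w ≡ x ⊎ w ≡ y
  diametral-resolver (_ , bounded , _) dxy (_ , _ , _ , dxw , dxy′ , dyw , split)
    with Dist-unique dxy′ dxy
  ... | refl with split | dxw | dyw
  ...   | inj₁ _    | _              | (nil , _)      = inj₂ refl
  ...   | inj₁ refl | _              | (cons _ _ , _) = ⊥-elim (m+1+n≰m _ (bounded _ _ _ dxw))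
  ...   | inj₂ _    | (nil , _)      | _              = inj₁ refl
  ...   | inj₂ refl | (cons _ _ , _) | _              = ⊥-elim (m+1+n≰m _ (bounded _ _ _ dyw))

  nonadjacent⇒Dist₂ : ∀ {x y} → Diameter G 2 → x ≢ y → ¬ Adj G x y → Dist G x y 2
  nonadjacent⇒Dist₂ {x} {y} (connected , bounded , _) x≢y ¬a with Connected⇒∃Dist connected x y
  ... | k , dxy with bounded x y k dxy | dxy
  ...   | _               | (nil , _)                = ⊥-elim (x≢y refl)
  ...   | _               | (cons a nil , _)         = ⊥-elim (¬a a)
  ...   | s≤s (s≤s z≤n)   | d@(cons _ (cons _ _) , _) = d

  -- z is one step nearer to w than v, so d(u,z) ≥ d(u,w) − (c − 1) = b + 1 ≥ 2.
  geodesic-next-far : ∀ {u v w b c} → Dist G u w (b + c) → Walk G u v b → u ≢ v →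
    Walk G v w c → v ≢ w → ∃[ z ] (Adj G v z × Adj (complement G) u z)
  geodesic-next-far _ nil u≢v _ _ = ⊥-elim (u≢v refl)
  geodesic-next-far _ (cons _ _) _ nil v≢w = ⊥-elim (v≢w refl)
  geodesic-next-far {u} {w = w} {suc b} {suc c} (_ , shortest) (cons _ _) _ (cons {y = z} avz zw) _ =
    z , avz , u≢z , ¬auz
    where
    u≢z : u ≢ z
    u≢z u≡z = n≮n c (m+n≤o⇒n≤o (suc b) (shortest c (subst (λ t → Walk G t w c) (sym u≡z) zw)))
    ¬auz : ¬ Adj G u z
    ¬auz auz = n≮n c (m+n≤o⇒n≤o b (s≤s⁻¹ (shortest (suc c) (cons auz zw))))

uncovered⇒¬Adj : ∀ {n} (G : Graph n) {S x y} → VertexCover G S → x ∉ S → y ∉ S → ¬ Adj G x y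
uncovered⇒¬Adj G cover x∉S y∉S a with cover _ _ a
... | inj₁ x∈S = x∉S x∈S
... | inj₂ y∈S = y∉S y∈S

module _ {n : ℕ} (G : Graph n) (S : Subset n) where

  private
    Gᶜ : Graph n
    Gᶜ = complement G

  Adj⇒complement-Dist₂ : ∀ {x y} → Diameter Gᶜ 2 → Adj G x y → Dist Gᶜ x y 2
  Adj⇒complement-Dist₂ diameter axy = nonadjacent⇒Dist₂ Gᶜ diameter (Adj⇒≢ G axy) (λ ᶜaxy → proj₂ ᶜaxy axy)

  complement-resolver : ∀ {u v w b c} → VertexCover G S → u ≢ v → u ∉ S → v ∉ S → w ∈ S →
    Dist G u w (b + c) → Dist G u v b → Dist G v w c →
    ∃[ z ] (z ∈ S × StronglyResolves Gᶜ z u v)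
  complement-resolver {u} {v} cover u≢v u∉S v∉S w∈S duw (uv , _) (vw , _)
    with geodesic-next-far G duw uv u≢v vw (λ { refl → v∉S w∈S })
  ... | z , avz , ᶜauz = z , z∈S , 1 , 1 , 2 , Adj⇒Dist₁ Gᶜ ᶜauz , Adj⇒Dist₁ Gᶜ ᶜauv , dvz , inj₂ refl
    where
    z∈S : z ∈ S
    z∈S with cover _ _ avz
    ... | inj₁ v∈S = ⊥-elim (v∉S v∈S)
    ... | inj₂ z∈S = z∈S
    ᶜauv : Adj Gᶜ u v
    ᶜauv = u≢v , uncovered⇒¬Adj G cover u∉S v∉S
    dvz : Dist Gᶜ v z 2
    dvz = Dist₂ Gᶜ (sym-adj Gᶜ ᶜauv) ᶜauz (Adj⇒≢ G avz) (λ ᶜavz → proj₂ ᶜavz avz)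

  cover-generator⇒complement-generator : VertexCover G S → StrongMetricGenerator G S →
    Connected Gᶜ → StrongMetricGenerator Gᶜ S
  cover-generator⇒complement-generator cover generator connected u v u≢v with u ∈? S | v ∈? S
  ... | yes u∈S | _ = u , u∈S , endpoint-resolvesˡ Gᶜ (proj₂ (Connected⇒∃Dist Gᶜ connected u v))
  ... | _ | yes v∈S = v , v∈S , endpoint-resolvesʳ Gᶜ (proj₂ (Connected⇒∃Dist Gᶜ connected u v))
  ... | no u∉S | no v∉S with generator u v u≢v
  ...   | w , w∈S , _ , _ , _ , duw , duv , dvw , inj₁ refl =
          complement-resolver cover u≢v u∉S v∉S w∈S duw duv dvw
  ...   | w , w∈S , _ , _ , _ , duw , duv , dvw , inj₂ refl
          with complement-resolver cover (≢-sym u≢v) v∉S u∉S w∈S dvw (Dist-sym G duv) duw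
  ...     | z , z∈S , resolves = z , z∈S , StronglyResolves-sym Gᶜ resolves

  complement-generator⇒cover : Diameter Gᶜ 2 → StrongMetricGenerator Gᶜ S → VertexCover G S
  complement-generator⇒cover diameter generator x y axy with x ∈? S | y ∈? S
  ... | yes x∈S | _ = inj₁ x∈S
  ... | _ | yes y∈S = inj₂ y∈S
  ... | no x∉S | no y∉S with generator x y (Adj⇒≢ G axy)
  ...   | w , w∈S , resolves
          with diametral-resolver Gᶜ diameter (Adj⇒complement-Dist₂ diameter axy) resolves
  ...     | inj₁ refl = ⊥-elim (x∉S w∈S)
  ...     | inj₂ refl = ⊥-elim (y∉S w∈S)

mainTheorem7 : ∀ {n} (G : Graph n) → Connected G → Diameter (complement G) 2 →
    (S : Subset n) →
    (StrongMetricGenerator G S × StrongMetricGenerator (complement G) S) ⇔ StrongResolvingCover G S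
mainTheorem7 G _ diameter@(connected , _) S = mk⇔
  (λ (generator , generatorᶜ) → complement-generator⇒cover G S diameter generatorᶜ , generator)
  (λ (cover , generator) → generator , cover-generator⇒complement-generator G S cover generator connected)
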